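{- Let $G\in\mathcal{G}(\widehat{C}_6,\widehat{C}_7)$ and $xy\in E(G)$. Then the following are equivalent: (1) the edge $xy$ is relating; (2) there exist an independent set $S_x\subseteq N_2(x)\setminus N(y)$ which dominates $N(x)\cap N_2(y)$, and an independent set $S_y\subseteq N_2(y)\setminus N(x)$ which dominates $N(y)\cap N_2(x)$.
   Context: Graphs are finite, simple, undirected; all neighborhoods are in $G$. $\mathcal{G}(\widehat{C}_6,\widehat{C}_7)$ is the class of graphs containing no (not necessarily induced) subgraph isomorphic to $C_6$ or $C_7$. $N(v)$ is the set of neighbors of $v$, $N_2(v)$ the set of vertices at distance exactly $2$ from $v$, and for a set $S$, $N[S]$ is the set of vertices at distance at most $1$ from $S$; $S$ dominates $T$ if $T\subseteq N[S]$. An independent set is maximal if it is not properly contained in another independent set. An edge $xy$ is relating if there exists an independent set $S$, containing neither $x$ nor $y$, such that both $S\cup\{x\}$ and $S\cup\{y\}$ are maximal independent sets of $G$. -}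

module Defs where

open import Data.Nat using (ℕ; zero; suc)
open import Data.Fin using (Fin; zero; suc; inject₁; fromℕ)
open import Data.Fin.Subset using (Subset; _∈_; _∉_; _⊆_; _∪_; ⁅_⁆)
open import Data.Product using (Σ; _×_; ∃; ∃-syntax)
open import Data.Sum using (_⊎_)
open import Data.Empty using (⊥)
open import Relation.Nullary using (¬_; Dec)
open import Relation.Binary.PropositionalEquality using (_≡_)
open import Function.Definitions using (Injective)

record Graph (n : ℕ) : Set₁ where
  field
    Adj     : Fin n → Fin n → Set
    adj?    : ∀ u v → Dec (Adj u v)
    sym     : ∀ {u v} → Adj u v → Adj v u
    irrefl  : ∀ {u} → ¬ Adj u u
open Graph public

module _ {n : ℕ} (G : Graph n) where

  -- G contains C_(m+1) as a (not necessarily induced) subgraph: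
  -- distinct vertices f 0, …, f m with f i ~ f (i+1) and f m ~ f 0.
  ContainsCycle : ℕ → Set
  ContainsCycle zero = ⊥  -- k = 0: not a cycle (unused)
  ContainsCycle (suc m) =
    Σ (Fin (suc m) → Fin n) λ f →
      Injective _≡_ _≡_ f
      × (∀ (i : Fin m) → Adj G (f (inject₁ i)) (f (suc i)))
      × Adj G (f (fromℕ m)) (f zero)

  InN : Fin n → Fin n → Set
  InN v w = Adj G v w

  InN₂ : Fin n → Fin n → Set
  InN₂ v w = ¬ (w ≡ v) × ¬ Adj G v w × ∃[ u ] (Adj G v u × Adj G u w)

  Independent : Subset n → Set
  Independent S = ∀ {u v} → u ∈ S → v ∈ S → ¬ Adj G u v

  MaximalIndependent : Subset n → Set
  MaximalIndependent S =
    Independent S × (∀ T → S ⊆ T → Independent T → T ⊆ S)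

  Dominates : Subset n → (Fin n → Set) → Set
  Dominates S P = ∀ t → P t → t ∈ S ⊎ ∃[ s ] (s ∈ S × Adj G s t)

  Relating : Fin n → Fin n → Set
  Relating x y = ∃[ S ] (x ∉ S × y ∉ S
                         × MaximalIndependent (S ∪ ⁅ x ⁆)
                         × MaximalIndependent (S ∪ ⁅ y ⁆))

  NoC6C7 : Set
  NoC6C7 = ¬ ContainsCycle 6 × ¬ ContainsCycle 7

-- A set I is maximal independent iff it is independent and N[I] contains
-- every vertex; both directions of the theorem are domination arguments.
--
-- (1 ⇒ 2)  If S ∪ {x} and S ∪ {y} are maximal independent, the part of S
--   lying in N₂(x) already dominates N(x) ∩ N₂(y): such a vertex w must be
--   dominated by S ∪ {y}, and the dominating vertex s ∈ S lies in N₂(x)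
--   through w.
--
-- (2 ⇒ 1)  Greedily extend Sₓ by vertices of S_y, and then by vertices far
--   from x and y (outside N[x] ∪ N[y]), to an independent set S.  S avoids
--   N[x] ∪ N[y], so S ∪ {x} and S ∪ {y} are independent, and S dominates
--   every vertex off N(x) ∩ N(y) other than x, y.  The only delicate case is
--   t ∈ N(y) ∩ N₂(x), dominated by b ∈ S_y with b ∉ S: then b was skipped
--   because a neighbour a ∈ Sₓ was present, and x u a b t y would be a
--   6-cycle (u a common neighbour of x and a).

module Submission where

open import Defs
open import Data.Nat using (ℕ)
open import Data.Fin using (Fin; zero; suc; inject₁; _≟_)
open import Data.Fin.Subset using (Subset; _∈_; _∉_; _⊆_; _∪_; ⁅_⁆)
open import Data.Fin.Subset.Properties using (_∈?_; x∈⁅y⁆⇒x≡y; x∈⁅x⁆; x∈p∪q⁻; p⊆p∪q; q⊆p∪q)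
open import Data.Fin.Properties using (any?)
open import Data.Vec using (Vec; []; _∷_; lookup; tabulate)
open import Data.Vec.Properties using (lookup∘tabulate; []=⇒lookup; lookup⇒[]=)
open import Data.Vec.Relation.Unary.All using ([]; _∷_)
open import Data.Vec.Relation.Unary.AllPairs using ([]; _∷_)
open import Data.Vec.Relation.Unary.Unique.Propositional using (Unique)
open import Data.Vec.Relation.Unary.Unique.Propositional.Properties using (lookup-injective)
open import Data.List using (List; []; _∷_; allFin)
open import Data.List.Relation.Unary.Any using (here; there)
open import Data.List.Membership.Propositional using () renaming (_∈_ to _∈ₗ_)
open import Data.List.Membership.Propositional.Properties using (∈-allFin)
open import Data.Product using (_×_; ∃-syntax; _,_; proj₁; proj₂)
open import Data.Sum using (_⊎_; inj₁; inj₂)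
import Data.Sum as Sum
open import Data.Empty using (⊥-elim)
open import Relation.Nullary using (¬_; Dec; yes; no; does)
open import Relation.Nullary.Decidable using (¬?; _×-dec_; _⊎-dec_; dec-true)
open import Relation.Unary using (Decidable)
open import Relation.Binary.PropositionalEquality using (_≡_; _≢_; refl; trans; ≢-sym)
  renaming (sym to ≡-sym)
open import Function using (id; _∘_)
open import Function.Bundles using (_⇔_; mk⇔)

module _ {n : ℕ} {P : Fin n → Set} (P? : Decidable P) where

  select : Subset n
  select = tabulate (λ v → does (P? v))

  ∈-select⁺ : ∀ {v} → P v → v ∈ select
  ∈-select⁺ {v} p = lookup⇒[]= v select (trans (lookup∘tabulate _ v) (dec-true (P? v) p))

  ∈-select⁻ : ∀ {v} → v ∈ select → P v
  ∈-select⁻ {v} v∈ with P? v | trans (≡-sym (lookup∘tabulate (λ u → does (P? u)) v)) ([]=⇒lookup v∈)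
  ... | yes p | _ = p
  ... | no _  | ()

module _ {n : ℕ} {S : Subset n} {v : Fin n} where

  ∈-∪⁅⁆ˡ : ∀ {u} → u ∈ S → u ∈ S ∪ ⁅ v ⁆
  ∈-∪⁅⁆ˡ = p⊆p∪q ⁅ v ⁆

  ∈-∪⁅⁆ʳ : v ∈ S ∪ ⁅ v ⁆
  ∈-∪⁅⁆ʳ = q⊆p∪q S ⁅ v ⁆ (x∈⁅x⁆ v)

  ∈-∪⁅⁆⁻ : ∀ {u} → u ∈ S ∪ ⁅ v ⁆ → u ∈ S ⊎ u ≡ v
  ∈-∪⁅⁆⁻ u∈ = Sum.map₂ (x∈⁅y⁆⇒x≡y v) (x∈p∪q⁻ S ⁅ v ⁆ u∈)

module _ {n : ℕ} (G : Graph n) where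

  adj⇒≢ : ∀ {p q} → Adj G p q → p ≢ q
  adj⇒≢ a refl = irrefl G a

  seen≢unseen : ∀ {q p r} → Adj G q p → ¬ Adj G q r → p ≢ r
  seen≢unseen a ¬a refl = ¬a a

  InN₂? : ∀ x v → Dec (InN₂ G x v)
  InN₂? x v = ¬? (v ≟ x) ×-dec ¬? (adj? G x v) ×-dec any? (λ u → adj? G x u ×-dec adj? G u v)

  _∈N[_] : Fin n → Subset n → Set
  t ∈N[ S ] = t ∈ S ⊎ ∃[ s ] (s ∈ S × Adj G s t)

  _∈N[_]? : ∀ t S → Dec (t ∈N[ S ])
  t ∈N[ S ]? = (t ∈? S) ⊎-dec any? (λ s → (s ∈? S) ×-dec adj? G s t)

  N[]-mono : ∀ {S T t} → S ⊆ T → t ∈N[ S ] → t ∈N[ T ]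
  N[]-mono S⊆T (inj₁ t∈S) = inj₁ (S⊆T t∈S)
  N[]-mono S⊆T (inj₂ (s , s∈S , a)) = inj₂ (s , S⊆T s∈S , a)

  independent-⊆ : ∀ {S T} → S ⊆ T → Independent G T → Independent G S
  independent-⊆ S⊆T iT u∈ v∈ = iT (S⊆T u∈) (S⊆T v∈)

  independent-∪⁅⁆ : ∀ {S v} → Independent G S → (∀ s → s ∈ S → ¬ Adj G s v) →
                    Independent G (S ∪ ⁅ v ⁆)
  independent-∪⁅⁆ {S} iS away {u} {w} u∈ w∈ with ∈-∪⁅⁆⁻ u∈ | ∈-∪⁅⁆⁻ w∈
  ... | inj₁ u∈S | inj₁ w∈S = iS u∈S w∈S
  ... | inj₁ u∈S | inj₂ refl = away u u∈S
  ... | inj₂ refl | inj₁ w∈S = away w w∈S ∘ sym G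
  ... | inj₂ refl | inj₂ refl = irrefl G

  dominating⇒maximal : ∀ {S} → Independent G S → (∀ t → t ∈N[ S ]) → MaximalIndependent G S
  dominating⇒maximal iS dom = iS , λ T S⊆T iT {t} t∈T → Sum.[ id , (λ (s , s∈S , a) →
    ⊥-elim (iT (S⊆T s∈S) t∈T a)) ] (dom t)

  maximal⇒dominating : ∀ {S} → MaximalIndependent G S → ∀ t → t ∈N[ S ]
  maximal⇒dominating {S} (iS , maximal) t with t ∈N[ S ]?
  ... | yes t∈N[S] = t∈N[S]
  ... | no t∉N[S] = inj₁ (maximal (S ∪ ⁅ t ⁆) ∈-∪⁅⁆ˡ
          (independent-∪⁅⁆ iS (λ s s∈S a → t∉N[S] (inj₂ (s , s∈S , a)))) ∈-∪⁅⁆ʳ)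

  record Extension (I : Subset n) (P : Fin n → Set) (vs : List (Fin n)) : Set where
    field
      set         : Subset n
      extends     : I ⊆ set
      independent : Independent G set
      within      : ∀ {v} → v ∈ set → v ∈ I ⊎ P v
      dominates   : ∀ v → v ∈ₗ vs → P v → v ∈N[ set ]
  open Extension

  dominates-∷ : ∀ {P : Fin n → Set} {S v vs} → (P v → v ∈N[ S ]) →
                (∀ u → u ∈ₗ vs → P u → u ∈N[ S ]) → ∀ u → u ∈ₗ v ∷ vs → P u → u ∈N[ S ]
  dominates-∷ dom-v dom-vs _ (here refl) = dom-v
  dominates-∷ dom-v dom-vs u (there u∈) = dom-vs u u∈

  keep : ∀ {I P vs v} (E : Extension I P vs) → (P v → v ∈N[ set E ]) → Extension I P (v ∷ vs)
  keep E dom-v = record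
    { set = set E ; extends = extends E ; independent = independent E ; within = within E
    ; dominates = dominates-∷ dom-v (dominates E) }

  extend-by : ∀ {I P vs} v → Dec (P v) → Extension I P vs → Extension I P (v ∷ vs)
  extend-by v (no ¬pv) E = keep E (⊥-elim ∘ ¬pv)
  extend-by v (yes pv) E with v ∈N[ set E ]?
  ... | yes dominated = keep E (λ _ → dominated)
  ... | no undominated = record
    { set         = set E ∪ ⁅ v ⁆
    ; extends     = ∈-∪⁅⁆ˡ ∘ extends E
    ; independent = independent-∪⁅⁆ (independent E) (λ s s∈ a → undominated (inj₂ (s , s∈ , a)))
    ; within      = λ u∈ → Sum.[ within E , (λ { refl → inj₂ pv }) ] (∈-∪⁅⁆⁻ u∈)
    ; dominates   = dominates-∷ (λ _ → inj₁ ∈-∪⁅⁆ʳ)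
                                (λ u u∈ pu → N[]-mono ∈-∪⁅⁆ˡ (dominates E u u∈ pu))
    }

  extend-along : ∀ {I P} → Decidable P → Independent G I → ∀ vs → Extension I P vs
  extend-along {I} P? iI [] = record
    { set = I ; extends = id ; independent = iI ; within = inj₁ ; dominates = λ _ () }
  extend-along P? iI (v ∷ vs) = extend-by v (P? v) (extend-along P? iI vs)

  extend : ∀ {I P} → Decidable P → Independent G I → Extension I P (allFin n)
  extend P? iI = extend-along P? iI (allFin n)

  hexagon : ∀ {a b c d e f} → Adj G a b → Adj G b c → Adj G c d → Adj G d e →
            Adj G e f → Adj G f a → Unique (a ∷ b ∷ c ∷ d ∷ e ∷ f ∷ []) → ContainsCycle G 6
  hexagon {a} {b} {c} {d} {e} {f} ab bc cd de ef fa distinct =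
    lookup walk , (λ {i} {j} → lookup-injective distinct i j) , step , fa
    where
    walk : Vec (Fin n) 6
    walk = a ∷ b ∷ c ∷ d ∷ e ∷ f ∷ []
    step : ∀ (i : Fin 5) → Adj G (lookup walk (inject₁ i)) (lookup walk (suc i))
    step zero = ab
    step (suc zero) = bc
    step (suc (suc zero)) = cd
    step (suc (suc (suc zero))) = de
    step (suc (suc (suc (suc zero)))) = ef

  SideWitness : Fin n → Fin n → Set
  SideWitness x y = ∃[ S ] (Independent G S
                            × (∀ v → v ∈ S → InN₂ G x v × ¬ InN G y v)
                            × Dominates G S (λ w → InN G x w × InN₂ G y w))

  -- (1 ⇒ 2): S ∩ N₂(x) witnesses the x-side.
  relating⇒side : ∀ {x y S} → x ∉ S → MaximalIndependent G (S ∪ ⁅ x ⁆) →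
                  MaximalIndependent G (S ∪ ⁅ y ⁆) → SideWitness x y
  relating⇒side {x} {y} {S} x∉S (iSx , _) maxSy =
    Sx , independent-⊆ (∈-∪⁅⁆ˡ ∘ inS) iSx , inside , dominated
    where
    member? : Decidable (λ v → v ∈ S × InN₂ G x v)
    member? v = (v ∈? S) ×-dec InN₂? x v
    Sx : Subset n
    Sx = select member?
    inS : ∀ {v} → v ∈ Sx → v ∈ S
    inS = proj₁ ∘ ∈-select⁻ member?
    iSy : Independent G (S ∪ ⁅ y ⁆)
    iSy = proj₁ maxSy
    inside : ∀ v → v ∈ Sx → InN₂ G x v × ¬ InN G y v
    inside v v∈ with ∈-select⁻ member? v∈
    ... | v∈S , v∈N₂x = v∈N₂x , iSy ∈-∪⁅⁆ʳ (∈-∪⁅⁆ˡ v∈S)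
    dominated : Dominates G Sx (λ w → InN G x w × InN₂ G y w)
    dominated w (axw , w≢y , ¬ayw , _) with maximal⇒dominating maxSy w
    ... | inj₁ w∈ = Sum.[ (λ w∈S → ⊥-elim (iSx ∈-∪⁅⁆ʳ (∈-∪⁅⁆ˡ w∈S) axw)) , ⊥-elim ∘ w≢y ] (∈-∪⁅⁆⁻ w∈)
    ... | inj₂ (s , s∈ , asw) with ∈-∪⁅⁆⁻ s∈
    ...   | inj₂ refl = ⊥-elim (¬ayw asw)
    ...   | inj₁ s∈S = inj₂ (s , ∈-select⁺ member? (s∈S , s∈N₂x) , asw)
      where
      s∈N₂x : InN₂ G x s
      s∈N₂x = (λ { refl → x∉S s∈S }) , iSx ∈-∪⁅⁆ʳ (∈-∪⁅⁆ˡ s∈S) , w , axw , sym G asw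

  Far : Fin n → Fin n → Fin n → Set
  Far x y v = ¬ v ≡ x × ¬ v ≡ y × ¬ Adj G x v × ¬ Adj G y v

  Far? : ∀ x y → Decidable (Far x y)
  Far? x y v = ¬? (v ≟ x) ×-dec ¬? (v ≟ y) ×-dec ¬? (adj? G x v) ×-dec ¬? (adj? G y v)

  side⇒far : ∀ {x y v} → Adj G x y → InN₂ G x v × ¬ InN G y v → Far x y v
  side⇒far axy ((v≢x , ¬axv , _) , ¬ayv) = v≢x , ≢-sym (seen≢unseen axy ¬axv) , ¬axv , ¬ayv

  far-swap : ∀ {x y v} → Far x y v → Far y x v
  far-swap (v≢x , v≢y , ¬axv , ¬ayv) = v≢y , v≢x , ¬ayv , ¬axv

  endpoint-maximal : ∀ {S x} → Independent G S → (∀ v → v ∈ S → ¬ Adj G x v) →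
                     (∀ t → ¬ t ≡ x → ¬ Adj G x t → t ∈N[ S ]) → MaximalIndependent G (S ∪ ⁅ x ⁆)
  endpoint-maximal {S} {x} iS away dom = dominating⇒maximal
    (independent-∪⁅⁆ iS (λ s s∈S → away s s∈S ∘ sym G)) dominated
    where
    dominated : ∀ t → t ∈N[ S ∪ ⁅ x ⁆ ]
    dominated t with t ≟ x | adj? G x t
    ... | yes refl | _ = inj₁ ∈-∪⁅⁆ʳ
    ... | no _ | yes axt = inj₂ (x , ∈-∪⁅⁆ʳ , axt)
    ... | no t≢x | no ¬axt = N[]-mono ∈-∪⁅⁆ˡ (dom t t≢x ¬axt)

  witnesses⇒relating : ¬ ContainsCycle G 6 → ∀ {x y} → Adj G x y →
                       SideWitness x y → SideWitness y x → Relating G x y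
  witnesses⇒relating noC6 {x} {y} axy (Sx , iSx , inSx , domSx) (Sy , iSy , inSy , domSy) =
    S , (λ x∈S → proj₁ (far x∈S) refl) , (λ y∈S → proj₁ (proj₂ (far y∈S)) refl) ,
    endpoint-maximal iS (λ v → proj₁ ∘ proj₂ ∘ proj₂ ∘ far)
      (λ t t≢x ¬axt → off-common t t≢x (λ { refl → ¬axt axy }) (¬axt ∘ proj₁)) ,
    endpoint-maximal iS (λ v → proj₂ ∘ proj₂ ∘ proj₂ ∘ far)
      (λ t t≢y ¬ayt → off-common t (λ { refl → ¬ayt (sym G axy) }) t≢y (¬ayt ∘ proj₂))
    where
    E₁ : Extension Sx (_∈ Sy) (allFin n)
    E₁ = extend (_∈? Sy) iSx
    E₂ : Extension (set E₁) (Far x y) (allFin n)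
    E₂ = extend (Far? x y) (independent E₁)
    S : Subset n
    S = set E₂
    iS : Independent G S
    iS = independent E₂
    Sx⊆S : Sx ⊆ S
    Sx⊆S = extends E₂ ∘ extends E₁

    far : ∀ {v} → v ∈ S → Far x y v
    far v∈S with within E₂ v∈S
    ... | inj₂ v-far = v-far
    ... | inj₁ v∈E₁ = Sum.[ side⇒far axy ∘ inSx _ , far-swap ∘ side⇒far (sym G axy) ∘ inSy _ ]
                           (within E₁ v∈E₁)

    x-side : ∀ t → Adj G x t → ¬ t ≡ y → ¬ Adj G y t → t ∈N[ S ]
    x-side t axt t≢y ¬ayt with domSx t (axt , t≢y , ¬ayt , x , sym G axy , axt)
    ... | inj₁ t∈Sx = ⊥-elim (proj₁ (proj₂ (proj₁ (inSx t t∈Sx))) axt)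
    ... | inj₂ (a , a∈Sx , aat) = inj₂ (a , Sx⊆S a∈Sx , aat)

    -- A 6-cycle x u a b t y arising when b ∈ S_y dominating t ∈ N(y) ∩ N₂(x)
    -- is itself dominated by a ∈ Sₓ.
    no-detour : ∀ {a b t} → a ∈ Sx → b ∈ Sy → Adj G a b → Adj G b t → Adj G y t →
                ¬ t ≡ x → ¬ Adj G x t → ContainsCycle G 6
    no-detour {a} {b} {t} a∈Sx b∈Sy aab abt ayt t≢x ¬axt
      with inSx a a∈Sx | inSy b b∈Sy
    ... | (a≢x , ¬axa , u , axu , aua) , ¬aya | (b≢y , ¬ayb , _) , ¬axb =
      hexagon axu aua aab abt (sym G ayt) (sym G axy)
        ( (adj⇒≢ axu ∷ ≢-sym a≢x ∷ seen≢unseen (sym G axy) ¬ayb ∷ ≢-sym t≢x ∷ adj⇒≢ axy ∷ [])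
        ∷ (adj⇒≢ aua ∷ seen≢unseen axu ¬axb ∷ seen≢unseen axu ¬axt
            ∷ seen≢unseen (sym G aua) (¬aya ∘ sym G) ∷ [])
        ∷ (adj⇒≢ aab ∷ ≢-sym (seen≢unseen ayt ¬aya) ∷ ≢-sym (seen≢unseen axy ¬axa) ∷ [])
        ∷ (adj⇒≢ abt ∷ b≢y ∷ [])
        ∷ (≢-sym (adj⇒≢ ayt) ∷ [])
        ∷ [] ∷ [])

    y-side : ∀ t → Adj G y t → ¬ t ≡ x → ¬ Adj G x t → t ∈N[ S ]
    y-side t ayt t≢x ¬axt with domSy t (ayt , t≢x , ¬axt , y , axy , ayt)
    ... | inj₁ t∈Sy = ⊥-elim (proj₁ (proj₂ (proj₁ (inSy t t∈Sy))) ayt)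
    ... | inj₂ (b , b∈Sy , abt) with dominates E₁ b (∈-allFin b) b∈Sy
    ...   | inj₁ b∈E₁ = inj₂ (b , extends E₂ b∈E₁ , abt)
    ...   | inj₂ (a , a∈E₁ , aab) with within E₁ a∈E₁
    ...     | inj₂ a∈Sy = ⊥-elim (iSy a∈Sy b∈Sy aab)
    ...     | inj₁ a∈Sx = ⊥-elim (noC6 (no-detour a∈Sx b∈Sy aab abt ayt t≢x ¬axt))

    off-common : ∀ t → ¬ t ≡ x → ¬ t ≡ y → ¬ (Adj G x t × Adj G y t) → t ∈N[ S ]
    off-common t t≢x t≢y not-both with adj? G x t | adj? G y t
    ... | yes axt | yes ayt = ⊥-elim (not-both (axt , ayt))
    ... | yes axt | no ¬ayt = x-side t axt t≢y ¬ayt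
    ... | no ¬axt | yes ayt = y-side t ayt t≢x ¬axt
    ... | no ¬axt | no ¬ayt = dominates E₂ t (∈-allFin t) (t≢x , t≢y , ¬axt , ¬ayt)

lemma11 : ∀ {n} (G : Graph n) → NoC6C7 G → (x y : Fin n) → Adj G x y →
    Relating G x y ⇔
      ((∃[ Sx ] (Independent G Sx
                 × (∀ v → v ∈ Sx → InN₂ G x v × ¬ InN G y v)
                 × Dominates G Sx (λ w → InN G x w × InN₂ G y w)))
       × (∃[ Sy ] (Independent G Sy
                 × (∀ v → v ∈ Sy → InN₂ G y v × ¬ InN G x v)
                 × Dominates G Sy (λ w → InN G y w × InN₂ G x w))))
lemma11 G (noC6 , _) x y axy = mk⇔
  (λ (S , x∉S , y∉S , maxSx , maxSy) →
     relating⇒side G x∉S maxSx maxSy , relating⇒side G y∉S maxSy maxSx)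
  (λ (witness-x , witness-y) → witnesses⇒relating G noC6 axy witness-x witness-y)
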